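{- The sets of patterns $\{31245,32145\}$ and $\{31254,32154\}$ are Wilf-equivalent, i.e. for every $n\ge1$ the number of permutations of $[n]$ avoiding both $31245$ and $32145$ equals the number avoiding both $31254$ and $32154$.
   Context: A permutation $\pi=\pi_1\cdots\pi_n$ contains a pattern $p=p_1\cdots p_k$ if there are indices $i_1<\cdots<i_k$ with $\pi_{i_j}<\pi_{i_m}$ if and only if $p_j<p_m$; otherwise it avoids $p$. -}

module Defs where

import Data.Nat
open import Data.Nat using (ℕ; zero; suc)
open import Data.Fin using (Fin; _<_; fromℕ<)
open import Data.Fin.Properties using (_<?_)
open import Data.Vec using (Vec; []; _∷_; lookup; map; concat; allFin)
open import Data.List using (List; []; _∷_; length; filter; concatMap)
open import Data.Product using (Σ; _×_; ∃)
open import Data.Sum using (_⊎_)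
open import Relation.Nullary using (¬_; Dec; yes; no)
open import Relation.Binary.PropositionalEquality using (_≡_)
open import Data.List.Relation.Unary.Unique.Propositional using (Unique)
open import Data.Vec using (toList)

IsPerm : ∀ {n} → Vec (Fin n) n → Set
IsPerm v = Unique (toList v)

StrictlyIncreasing : ∀ {k n} → (Fin k → Fin n) → Set
StrictlyIncreasing {k} f = ∀ (j m : Fin k) → j < m → f j < f m

Contains : ∀ {n k} → Vec (Fin n) n → Vec (Fin k) k → Set
Contains {n} {k} π p =
  Σ (Fin k → Fin n) λ ι → StrictlyIncreasing ι ×
    (∀ (j m : Fin k) →
       ((lookup π (ι j) < lookup π (ι m)) → (lookup p j < lookup p m)) ×
       ((lookup p j < lookup p m) → (lookup π (ι j) < lookup π (ι m))))

Avoids : ∀ {n k} → Vec (Fin n) n → Vec (Fin k) k → Set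
Avoids π p = ¬ Contains π p

allWords : ∀ {n} (m : ℕ) → List (Vec (Fin n) m)
allWords zero = [] ∷ []
allWords {n} (suc m) =
  concatMap (λ a → Data.List.map (a ∷_) (allWords m)) (toList (allFin n))

DecPerm : ∀ {n} → (Vec (Fin n) n → Set) → Vec (Fin n) n → Set
DecPerm P v = Dec (IsPerm v × P v)

countPerms : (n : ℕ) (P : Vec (Fin n) n → Set) →
             (∀ v → DecPerm P v) → ℕ
countPerms n P d = length (filter d (allWords n))

-- Patterns, written with entries 0-based (31245 ↦ 2 0 1 3 4).
f : (i : ℕ) → {{_ : i Data.Nat.< 5}} → Fin 5
f i {{p}} = fromℕ< p

instance
  lt0 : 0 Data.Nat.< 5
  lt0 = Data.Nat.s≤s Data.Nat.z≤n
  lt1 : 1 Data.Nat.< 5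
  lt1 = Data.Nat.s≤s (Data.Nat.s≤s Data.Nat.z≤n)
  lt2 : 2 Data.Nat.< 5
  lt2 = Data.Nat.s≤s (Data.Nat.s≤s (Data.Nat.s≤s Data.Nat.z≤n))
  lt3 : 3 Data.Nat.< 5
  lt3 = Data.Nat.s≤s (Data.Nat.s≤s (Data.Nat.s≤s (Data.Nat.s≤s Data.Nat.z≤n)))
  lt4 : 4 Data.Nat.< 5
  lt4 = Data.Nat.s≤s (Data.Nat.s≤s (Data.Nat.s≤s (Data.Nat.s≤s (Data.Nat.s≤s Data.Nat.z≤n))))

p31245 p32145 p31254 p32154 : Vec (Fin 5) 5
p31245 = f 2 ∷ f 0 ∷ f 1 ∷ f 3 ∷ f 4 ∷ []
p32145 = f 2 ∷ f 1 ∷ f 0 ∷ f 3 ∷ f 4 ∷ []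
p31254 = f 2 ∷ f 0 ∷ f 1 ∷ f 4 ∷ f 3 ∷ []
p32154 = f 2 ∷ f 1 ∷ f 0 ∷ f 4 ∷ f 3 ∷ []

AvoidsBoth : ∀ {n} → Vec (Fin 5) 5 → Vec (Fin 5) 5 → Vec (Fin n) n → Set
AvoidsBoth p q π = Avoids π p × Avoids π q

-- Call a position x of σ active if some i < j < k < x has σ j, σ k < σ i < σ x, i.e. σ x lies
-- above the 3 of an occurrence of 312 or 321 to its left. A permutation contains 31245 or 32145
-- iff some active position l has a larger entry to its right (BadPair _>_), and it contains
-- 31254 or 32154 iff some position l has a smaller entry σ m to its right that still lies above
-- the 3 of such an occurrence before l (BadPair _<_).
--
-- Let σ ∼ τ when σ and τ agree at every position that is not active in both. By induction on
-- the position, ∼-related permutations have a 312/321 before position p with its 3 below v for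
-- exactly the same p and v, so ∼ is an equivalence relation. Each class contains exactly one
-- permutation without bad pairs of a given kind: swapping a bad pair stays in the class and
-- moves the permutation lexicographically, which gives existence; two distinct such members
-- would swap the smallest value on which they disagree, and this crossing is a bad pair in one
-- of them, which gives uniqueness. Sending each avoider of one pair of patterns to the member of
-- its class that avoids the other pair is therefore injective, in both directions.
module Submission where

open import Defs
open import Data.Empty using (⊥-elim)
open import Data.Fin as Fin using (Fin; zero; suc; _<_; _>_; punchOut)
open import Data.Fin.Induction using (<-wellFounded; >-wellFounded)
open import Data.Fin.Patterns using (0F; 1F; 2F; 3F; 4F)
open import Data.Fin.Permutation.Components using (transpose; transpose-inverse)
open import Data.Fin.Properties
  using (_≟_; _<?_; <-cmp; <-trans; <-irrefl; <-asym; <⇒≢; any?; punchOut-injective; injective⇒≤)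
open import Data.List as List using (List; []; _∷_; _++_; length; filter)
open import Data.List.Membership.Propositional using (_∈_)
open import Data.List.Membership.Propositional.Properties
  using (∈-∃++; ∈-++⁻; ∈-++⁺ˡ; ∈-++⁺ʳ; ∈-map⁺; ∈-map⁻; ∈-filter⁺; ∈-filter⁻; ∈-concatMap⁺)
open import Data.List.Properties using (length-map; length-++-sucʳ)
open import Data.List.Relation.Binary.Subset.Propositional using (_⊆_)
open import Data.List.Relation.Unary.All as All using (All; []; _∷_)
import Data.List.Relation.Unary.All.Properties as All
import Data.List.Relation.Unary.AllPairs as AllPairs
import Data.List.Relation.Unary.AllPairs.Properties as AllPairs
open import Data.List.Relation.Unary.Any as Any using (here; there)
open import Data.List.Relation.Unary.Unique.Propositional using (Unique; []; _∷_)
import Data.List.Relation.Unary.Unique.Propositional.Properties as Unique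
open import Data.Nat as ℕ using (ℕ; _≤_; z≤n; s≤s; z<s; s<s)
open import Data.Nat.Properties using (<⇒≤; <-≤-trans; ≤-refl; ≤-antisym; 1+n≰n; module ≤-Reasoning)
open import Data.Product using (∃; ∃-syntax; _×_; _,_; proj₁; proj₂)
import Data.Product as Product
open import Data.Sum using (_⊎_; inj₁; inj₂; [_,_]′)
import Data.Sum as Sum
open import Data.Vec as Vec using (Vec; []; _∷_; lookup; tabulate; toList; allFin)
open import Data.Vec.Membership.Propositional.Properties using (∈-lookup; ∈-allFin⁺; ∈-toList⁺)
open import Data.Vec.Properties
  using (lookup-map; lookup∘tabulate; tabulate∘lookup; tabulate-cong; ∷-injectiveˡ; ∷-injectiveʳ)
open import Data.Vec.Relation.Binary.Lex.Strict as Lex using (Lex-<; this; next)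
open import Data.Vec.Relation.Unary.Linked using (Linked; [-]; _∷_)
open import Data.Vec.Relation.Unary.Linked.Properties using (lookup⁺)
open import Function using (_∘_; id)
open import Function.Definitions using (Injective)
open import Induction.WellFounded using (WellFounded; Acc; acc)
open import Level using (0ℓ)
open import Relation.Binary using (Rel; tri<; tri≈; tri>)
import Relation.Binary.Construct.On as On
open import Relation.Binary.PropositionalEquality
open import Relation.Nullary using (¬_; Dec; yes; no; contradiction)
open import Relation.Nullary.Decidable using (True; toWitness; map′; _×-dec_; dec-true; dec-false)
open import Relation.Unary using (Pred; Decidable)

module _ {A : Set} where

  unique-⊆⇒length-≤ : {xs ys : List A} → Unique xs → xs ⊆ ys → length xs ≤ length ys
  unique-⊆⇒length-≤ {[]} _ _ = z≤n
  unique-⊆⇒length-≤ {x ∷ xs} (x∉xs ∷ xs!) x∷xs⊆ys with ∈-∃++ (x∷xs⊆ys (here refl))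
  ... | as , bs , refl = begin
    ℕ.suc (length xs)         ≤⟨ s≤s (unique-⊆⇒length-≤ xs! xs⊆as++bs) ⟩
    ℕ.suc (length (as ++ bs)) ≡⟨ length-++-sucʳ as x bs ⟨
    length (as ++ x ∷ bs)     ∎
    where
    open ≤-Reasoning
    xs⊆as++bs : xs ⊆ as ++ bs
    xs⊆as++bs y∈xs with ∈-++⁻ as (x∷xs⊆ys (there y∈xs))
    ... | inj₁ y∈as         = ∈-++⁺ˡ y∈as
    ... | inj₂ (here refl)  = contradiction refl (All.lookup x∉xs y∈xs)
    ... | inj₂ (there y∈bs) = ∈-++⁺ʳ as y∈bs

  module _ {P : Pred A 0ℓ} (f : A → A)
           (f-injective : ∀ {x y} → P x → P y → f x ≡ f y → x ≡ y) where

    unique-map⁺ : {xs : List A} → All P xs → Unique xs → Unique (List.map f xs)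
    unique-map⁺ [] [] = []
    unique-map⁺ (px ∷ pxs) (x∉xs ∷ xs!) =
      All.map⁺ (All.zipWith (λ (x≢y , py) fx≡fy → x≢y (f-injective px py fx≡fy)) (x∉xs , pxs))
      ∷ unique-map⁺ pxs xs!

    length-filter-≤ : {Q : Pred A 0ℓ} (P? : Decidable P) (Q? : Decidable Q) {W : List A} →
                      Unique W → (∀ x → x ∈ W) → (∀ {x} → P x → Q (f x)) →
                      length (filter P? W) ≤ length (filter Q? W)
    length-filter-≤ P? Q? {W} W! W-complete f-maps = begin
      length (filter P? W)              ≡⟨ length-map f (filter P? W) ⟨
      length (List.map f (filter P? W)) ≤⟨ unique-⊆⇒length-≤ image! image⊆ ⟩
      length (filter Q? W)              ∎
      where
      open ≤-Reasoning
      image! : Unique (List.map f (filter P? W))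
      image! = unique-map⁺ (All.all-filter P? W) (Unique.filter⁺ P? W!)
      image⊆ : List.map f (filter P? W) ⊆ filter Q? W
      image⊆ y∈ with ∈-map⁻ f y∈
      ... | x , x∈ , refl =
        ∈-filter⁺ Q? (W-complete (f x)) (f-maps (proj₂ (∈-filter⁻ P? {xs = W} x∈)))

toList-tabulate : ∀ {A : Set} {k} (f : Fin k → A) → toList (tabulate f) ≡ List.tabulate f
toList-tabulate {k = ℕ.zero}  f = refl
toList-tabulate {k = ℕ.suc k} f = cong (f zero ∷_) (toList-tabulate (f ∘ suc))

Unique-toList⇒lookup-injective : ∀ {A : Set} {k} {xs : Vec A k} → Unique (toList xs) →
                                 Injective _≡_ _≡_ (lookup xs)
Unique-toList⇒lookup-injective {xs = x ∷ xs} _ {zero} {zero} _ = refl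
Unique-toList⇒lookup-injective {xs = x ∷ xs} (x∉xs ∷ _) {zero} {suc j} x≡xs[j] =
  contradiction x≡xs[j] (All.lookup x∉xs (∈-toList⁺ (∈-lookup j xs)))
Unique-toList⇒lookup-injective {xs = x ∷ xs} (x∉xs ∷ _) {suc i} {zero} xs[i]≡x =
  contradiction (sym xs[i]≡x) (All.lookup x∉xs (∈-toList⁺ (∈-lookup i xs)))
Unique-toList⇒lookup-injective {xs = x ∷ xs} (_ ∷ xs!) {suc i} {suc j} xs[i]≡xs[j] =
  cong suc (Unique-toList⇒lookup-injective xs! xs[i]≡xs[j])

IsPerm⇒injective : ∀ {n} {π : Vec (Fin n) n} → IsPerm π → Injective _≡_ _≡_ (lookup π)
IsPerm⇒injective = Unique-toList⇒lookup-injective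

injective⇒IsPerm : ∀ {n} {σ : Fin n → Fin n} → Injective _≡_ _≡_ σ → IsPerm (tabulate σ)
injective⇒IsPerm {σ = σ} σ-injective =
  subst Unique (sym (toList-tabulate σ)) (Unique.tabulate⁺ σ-injective)

injective⇒surjective : ∀ {n} {f : Fin n → Fin n} → Injective _≡_ _≡_ f → ∀ y → ∃ λ x → f x ≡ y
injective⇒surjective {ℕ.suc n} {f} f-injective y with any? (λ x → f x ≟ y)
... | yes hit = hit
... | no miss = contradiction (injective⇒≤ g-injective) 1+n≰n
  where
  y∉image : ∀ x → y ≢ f x
  y∉image x y≡fx = miss (x , sym y≡fx)
  g : Fin (ℕ.suc n) → Fin n
  g x = punchOut (y∉image x)
  g-injective : Injective _≡_ _≡_ g
  g-injective = f-injective ∘ punchOut-injective (y∉image _) (y∉image _)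

module _ {n : ℕ} where

  allWords-complete : ∀ {m} (w : Vec (Fin n) m) → w ∈ allWords m
  allWords-complete []                 = here refl
  allWords-complete {ℕ.suc m} (a ∷ w) = ∈-concatMap⁺ (λ b → List.map (b ∷_) (allWords m))
    (Any.map (λ { refl → ∈-map⁺ (a ∷_) (allWords-complete w) }) (∈-toList⁺ (∈-allFin⁺ a)))

  allWords-unique : ∀ m → Unique (allWords {n} m)
  allWords-unique ℕ.zero    = [] ∷ []
  allWords-unique (ℕ.suc m) =
    Unique.concat⁺ (All.map⁺ (All.universal (λ _ → Unique.map⁺ ∷-injectiveʳ (allWords-unique m)) _))
                   (AllPairs.map⁺ (AllPairs.map disjoint letters!))
    where
    letters! : Unique (toList (allFin n))
    letters! = subst Unique (sym (toList-tabulate id)) (Unique.allFin⁺ n)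
    disjoint : ∀ {a b} → a ≢ b → ∀ {w} →
               ¬ (w ∈ List.map (a ∷_) (allWords m) × w ∈ List.map (b ∷_) (allWords m))
    disjoint a≢b (w∈a∷ , w∈b∷) with ∈-map⁻ _ w∈a∷ | ∈-map⁻ _ w∈b∷
    ... | _ , _ , refl | _ , _ , eq = a≢b (∷-injectiveˡ eq)

StrictlyIncreasing⇒reflects-< : ∀ {k n} {f : Fin k → Fin n} → StrictlyIncreasing f →
                                ∀ {a b} → f a < f b → a < b
StrictlyIncreasing⇒reflects-< f↑ {a} {b} fa<fb with <-cmp a b
... | tri< a<b _ _ = a<b
... | tri≈ _ refl _ = contradiction fa<fb (<-irrefl refl)
... | tri> _ _ b<a = contradiction fa<fb (<-asym (f↑ _ _ b<a))

module _ {A : Set} {_≺_ : Rel A 0ℓ} where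

  TableLex : ∀ {k} → Rel (Fin k → A) 0ℓ
  TableLex f g = Lex-< _≡_ _≺_ (tabulate f) (tabulate g)

  TableLex-intro : ∀ {k} {f g : Fin k → A} (l : Fin k) →
                   (∀ {x} → x < l → f x ≡ g x) → f l ≺ g l → TableLex f g
  TableLex-intro zero    _     fl≺gl = this fl≺gl refl
  TableLex-intro (suc l) agree fl≺gl = next (agree z<s) (TableLex-intro l (agree ∘ s<s) fl≺gl)

  TableLex-wellFounded : ∀ {k} → WellFounded _≺_ → WellFounded (TableLex {k})
  TableLex-wellFounded ≺-wf = On.wellFounded tabulate (Lex.<-wellFounded trans ≺-respʳ-≡ ≺-wf)
    where
    ≺-respʳ-≡ : ∀ {x y z} → y ≡ z → x ≺ y → x ≺ z
    ≺-respʳ-≡ refl x≺y = x≺y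

transpose-matchˡ : ∀ {n} (i j : Fin n) → transpose i j i ≡ j
transpose-matchˡ i j rewrite dec-true (i ≟ i) refl = refl

transpose-matchʳ : ∀ {n} (i j : Fin n) → transpose i j j ≡ i
transpose-matchʳ i j with j ≟ i
... | yes refl = refl
... | no _ rewrite dec-true (j ≟ j) refl = refl

transpose-other : ∀ {n} {i j k : Fin n} → k ≢ i → k ≢ j → transpose i j k ≡ k
transpose-other {i = i} {j} {k} k≢i k≢j
  rewrite dec-false (k ≟ i) k≢i | dec-false (k ≟ j) k≢j = refl

transpose-injective : ∀ {n} (i j : Fin n) → Injective _≡_ _≡_ (transpose i j)
transpose-injective i j {x} {y} tx≡ty = begin
  x                               ≡⟨ transpose-inverse j i ⟨
  transpose j i (transpose i j x) ≡⟨ cong (transpose j i) tx≡ty ⟩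
  transpose j i (transpose i j y) ≡⟨ transpose-inverse j i ⟩
  y                               ∎
  where open ≡-Reasoning

module _ {n : ℕ} where

  Peak : (Fin n → Fin n) → Fin n → Fin n → Set
  Peak σ p v = ∃[ i ] ∃[ j ] ∃[ k ] i < j × j < k × k < p × σ j < σ i × σ k < σ i × σ i < v

  peak? : ∀ σ p v → Dec (Peak σ p v)
  peak? σ p v = any? λ i → any? λ j → any? λ k →
    i <? j ×-dec j <? k ×-dec k <? p ×-dec σ j <? σ i ×-dec σ k <? σ i ×-dec σ i <? v

  Peak-mono : ∀ {σ p p′ v v′} → p Fin.≤ p′ → v Fin.≤ v′ → Peak σ p v → Peak σ p′ v′
  Peak-mono p≤p′ v≤v′ (i , j , k , i<j , j<k , k<p , σj<σi , σk<σi , σi<v) =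
    i , j , k , i<j , j<k , <-≤-trans k<p p≤p′ , σj<σi , σk<σi , <-≤-trans σi<v v≤v′

  Peak-transport : ∀ {σ τ p v} → (∀ {x} → x < p → σ x < v → σ x ≡ τ x ⊎ Peak τ p v) →
                   Peak σ p v → Peak τ p v
  Peak-transport entry (i , j , k , i<j , j<k , k<p , σj<σi , σk<σi , σi<v)
    with entry (<-trans i<j (<-trans j<k k<p)) σi<v
       | entry (<-trans j<k k<p) (<-trans σj<σi σi<v)
       | entry k<p (<-trans σk<σi σi<v)
  ... | inj₂ peak  | _          | _          = peak
  ... | _          | inj₂ peak  | _          = peak
  ... | _          | _          | inj₂ peak  = peak
  ... | inj₁ σi≡τi | inj₁ σj≡τj | inj₁ σk≡τk =
    i , j , k , i<j , j<k , k<p ,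
    subst₂ _<_ σj≡τj σi≡τi σj<σi , subst₂ _<_ σk≡τk σi≡τi σk<σi , subst (_< _) σi≡τi σi<v

  Peak-resp-prefix : ∀ {σ τ p v} → (∀ {x} → x < p → σ x ≡ τ x) → Peak σ p v → Peak τ p v
  Peak-resp-prefix agree = Peak-transport λ x<p _ → inj₁ (agree x<p)

  Active : (Fin n → Fin n) → Fin n → Set
  Active σ x = Peak σ x (σ x)

  _∼_ : Rel (Fin n → Fin n) 0ℓ
  σ ∼ τ = ∀ x → σ x ≡ τ x ⊎ Active σ x × Active τ x

  ≗⇒∼ : ∀ {σ τ} → σ ≗ τ → σ ∼ τ
  ≗⇒∼ σ≗τ = inj₁ ∘ σ≗τ

  ∼-sym : ∀ {σ τ} → σ ∼ τ → τ ∼ σ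
  ∼-sym σ∼τ = Sum.map sym Product.swap ∘ σ∼τ

  -- By induction on p: an entry of the peak on which σ and τ disagree is active,
  -- and its own peak, further left, survives in τ.
  Peak-transfer : ∀ {σ τ p v} → σ ∼ τ → Peak σ p v → Peak τ p v
  Peak-transfer {σ} {τ} σ∼τ = go (<-wellFounded _)
    where
    go : ∀ {p v} → Acc _<_ p → Peak σ p v → Peak τ p v
    go (acc smaller) = Peak-transport λ {x} x<p σx<v → Sum.map₂
      (λ (x-active , _) → Peak-mono (<⇒≤ x<p) (<⇒≤ σx<v) (go (smaller x<p) x-active)) (σ∼τ x)

  Active-transfer : ∀ {σ τ x} → σ ∼ τ → σ x ≡ τ x → Active σ x → Active τ x
  Active-transfer {τ = τ} {x} σ∼τ σx≡τx = subst (Peak τ x) σx≡τx ∘ Peak-transfer σ∼τ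

  ∼-trans : ∀ {σ τ ρ} → σ ∼ τ → τ ∼ ρ → σ ∼ ρ
  ∼-trans σ∼τ τ∼ρ x with σ∼τ x | τ∼ρ x
  ... | inj₁ σx≡τx | inj₁ τx≡ρx = inj₁ (trans σx≡τx τx≡ρx)
  ... | inj₁ σx≡τx | inj₂ (τx-active , ρx-active) =
    inj₂ (Active-transfer (∼-sym σ∼τ) (sym σx≡τx) τx-active , ρx-active)
  ... | inj₂ (σx-active , τx-active) | inj₁ τx≡ρx =
    inj₂ (σx-active , Active-transfer τ∼ρ τx≡ρx τx-active)
  ... | inj₂ (σx-active , _) | inj₂ (_ , ρx-active) = inj₂ (σx-active , ρx-active)

  ≢⇒Active : ∀ {σ τ x} → σ ∼ τ → σ x ≢ τ x → Active σ x × Active τ x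
  ≢⇒Active {x = x} σ∼τ σx≢τx = [ (λ σx≡τx → contradiction σx≡τx σx≢τx) , id ]′ (σ∼τ x)

  swap : (Fin n → Fin n) → Fin n → Fin n → Fin n → Fin n
  swap σ l m = σ ∘ transpose l m

  swap-before : ∀ σ {l m x} → l < m → x < l → swap σ l m x ≡ σ x
  swap-before σ l<m x<l = cong σ (transpose-other (<⇒≢ x<l) (<⇒≢ (<-trans x<l l<m)))

  swap-injective : ∀ {σ} l m → Injective _≡_ _≡_ σ → Injective _≡_ _≡_ (swap σ l m)
  swap-injective l m σ-injective = transpose-injective l m ∘ σ-injective

  -- Both swapped values lie above a peak before l, so l and m stay active.
  ∼-swap : ∀ {σ l m} → l < m → Active σ l → Peak σ l (σ m) → σ ∼ swap σ l m
  ∼-swap {σ} {l} {m} l<m l-active peak x = at x (x ≟ l) (x ≟ m)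
    where
    τ = swap σ l m
    before-l : ∀ {v} → Peak σ l v → Peak τ l v
    before-l = Peak-resp-prefix (sym ∘ swap-before σ l<m)
    at : ∀ x → Dec (x ≡ l) → Dec (x ≡ m) → σ x ≡ τ x ⊎ Active σ x × Active τ x
    at x (yes refl) _ =
      inj₂ (l-active , subst (Peak τ l) (cong σ (sym (transpose-matchˡ l m))) (before-l peak))
    at x (no _) (yes refl) =
      inj₂ (Peak-mono (<⇒≤ l<m) ≤-refl peak ,
            subst (Peak τ m) (cong σ (sym (transpose-matchʳ l m)))
                  (Peak-mono (<⇒≤ l<m) ≤-refl (before-l l-active)))
    at x (no x≢l) (no x≢m) = inj₁ (cong σ (sym (transpose-other x≢l x≢m)))

  record BadPair (_≺_ : Rel (Fin n) 0ℓ) (σ : Fin n → Fin n) : Set where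
    constructor badPair
    field
      {l m}    : Fin n
      l<m      : l < m
      inverted : σ m ≺ σ l
      l-active : Active σ l
      peak     : Peak σ l (σ m)

  badPair? : ∀ {_≺_} → (∀ a b → Dec (a ≺ b)) → Decidable (BadPair _≺_)
  badPair? _≺?_ σ = map′ (λ (_ , _ , l<m , inv , act , pk) → badPair l<m inv act pk)
                         (λ (badPair l<m inv act pk) → _ , _ , l<m , inv , act , pk)
    (any? λ l → any? λ m → l <? m ×-dec σ m ≺? σ l ×-dec peak? σ l (σ l) ×-dec peak? σ l (σ m))

  BadPair-resp-≗ : ∀ {_≺_ σ τ} → σ ≗ τ → BadPair _≺_ σ → BadPair _≺_ τ
  BadPair-resp-≗ {_≺_} {σ} {τ} σ≗τ (badPair {l} {m} l<m σm≺σl l-active peak) =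
    badPair l<m (subst₂ _≺_ (σ≗τ m) (σ≗τ l) σm≺σl) (Active-transfer σ∼τ (σ≗τ l) l-active)
            (subst (Peak τ l) (σ≗τ m) (Peak-transfer σ∼τ peak))
    where
    σ∼τ = ≗⇒∼ σ≗τ

  record Normalisation (Bad : Pred (Fin n → Fin n) 0ℓ) (σ : Fin n → Fin n) : Set where
    field
      form           : Fin n → Fin n
      ∼form          : σ ∼ form
      form-injective : Injective _≡_ _≡_ σ → Injective _≡_ _≡_ form
      form-good      : ¬ Bad form

  open Normalisation

  -- Swapping a bad pair moves the table down lexicographically.
  normalise : ∀ {_≺_} → WellFounded _≺_ → (∀ a b → Dec (a ≺ b)) →
              ∀ σ → Normalisation (BadPair _≺_) σ
  normalise {_≺_} ≺-wf _≺?_ σ = go σ (TableLex-wellFounded ≺-wf σ)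
    where
    go : ∀ σ → Acc (TableLex {_≺_ = _≺_}) σ → Normalisation (BadPair _≺_) σ
    go σ (acc smaller) with badPair? _≺?_ σ
    ... | no good = record
      { form = σ ; ∼form = ≗⇒∼ (λ _ → refl) ; form-injective = id ; form-good = good }
    ... | yes (badPair {l} {m} l<m σm≺σl l-active peak) = record
      { form           = form N
      ; ∼form          = ∼-trans (∼-swap l<m l-active peak) (∼form N)
      ; form-injective = form-injective N ∘ swap-injective l m
      ; form-good      = form-good N
      }
      where
      swap-smaller : TableLex (swap σ l m) σ
      swap-smaller = TableLex-intro l (swap-before σ l<m)
        (subst (_≺ σ l) (cong σ (sym (transpose-matchˡ l m))) σm≺σl)
      N : Normalisation (BadPair _≺_) (swap σ l m)
      N = go (swap σ l m) (smaller swap-smaller)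

  normalise< : ∀ σ → Normalisation (BadPair _<_) σ
  normalise< = normalise <-wellFounded _<?_

  normalise> : ∀ σ → Normalisation (BadPair _>_) σ
  normalise> = normalise >-wellFounded (λ a b → b <? a)

  record Crossing (τ τ′ : Fin n → Fin n) (c c′ : Fin n) : Set where
    constructor crossing
    field
      meet  : τ c ≡ τ′ c′
      rise  : τ c < τ′ c
      rise′ : τ′ c′ < τ c′

  Crossing-sym : ∀ {τ τ′ c c′} → Crossing τ τ′ c c′ → Crossing τ′ τ c′ c
  Crossing-sym (crossing meet rise rise′) = crossing (sym meet) rise′ rise

  crossing⇒BadPair> : ∀ {τ τ′ c c′} → τ ∼ τ′ → Crossing τ τ′ c c′ → c < c′ →
                      BadPair _>_ τ ⊎ BadPair _>_ τ′
  crossing⇒BadPair> {τ} {c′ = c′} τ∼τ′ (crossing meet rise rise′) c<c′ =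
    inj₁ (badPair c<c′ τc<τc′ c-active (Peak-mono ≤-refl (<⇒≤ τc<τc′) c-active))
    where
    τc<τc′ = subst (_< τ c′) (sym meet) rise′
    c-active = proj₁ (≢⇒Active τ∼τ′ (<⇒≢ rise))

  crossing⇒BadPair< : ∀ {τ τ′ c c′} → τ ∼ τ′ → Crossing τ τ′ c c′ → c < c′ →
                      BadPair _<_ τ ⊎ BadPair _<_ τ′
  crossing⇒BadPair< {τ′ = τ′} {c} τ∼τ′ (crossing meet rise rise′) c<c′ =
    inj₂ (badPair c<c′ (subst (_< τ′ c) meet rise) c-active′
                  (subst (Peak τ′ c) meet (Peak-transfer τ∼τ′ c-active)))
    where
    c-active  = proj₁ (≢⇒Active τ∼τ′ (<⇒≢ rise))
    c-active′ = proj₂ (≢⇒Active τ∼τ′ (<⇒≢ rise))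

  AgreeBelow : (τ τ′ : Fin n → Fin n) → Fin n → Set
  AgreeBelow τ τ′ v = ∀ y → τ y < v ⊎ τ′ y < v → τ y ≡ τ′ y

  AgreeBelow-sym : ∀ {τ τ′ v} → AgreeBelow τ τ′ v → AgreeBelow τ′ τ v
  AgreeBelow-sym agree y = sym ∘ agree y ∘ Sum.swap

  disagreement⇒crossing : ∀ {τ τ′ c} → Injective _≡_ _≡_ τ → Injective _≡_ _≡_ τ′ →
                          AgreeBelow τ τ′ (τ c) → τ c ≢ τ′ c → ∃ (Crossing τ τ′ c)
  disagreement⇒crossing {τ} {τ′} {c} τ-injective τ′-injective agree τc≢τ′c =
    c′ , crossing (sym τ′c′≡τc) τc<τ′c τ′c′<τc′
    where
    τc<τ′c : τ c < τ′ c
    τc<τ′c with <-cmp (τ c) (τ′ c)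
    ... | tri< lt _ _ = lt
    ... | tri≈ _ eq _ = contradiction eq τc≢τ′c
    ... | tri> _ _ gt = contradiction (agree c (inj₂ gt)) τc≢τ′c
    c′ = proj₁ (injective⇒surjective τ′-injective (τ c))
    τ′c′≡τc = proj₂ (injective⇒surjective τ′-injective (τ c))
    τ′c′<τc′ : τ′ c′ < τ c′
    τ′c′<τc′ with <-cmp (τ c′) (τ c)
    ... | tri< lt _ _ = contradiction (trans (agree c′ (inj₁ lt)) τ′c′≡τc) (<⇒≢ lt)
    ... | tri≈ _ eq _ = contradiction (trans (sym τ′c′≡τc) (cong τ′ (τ-injective eq))) τc≢τ′c
    ... | tri> _ _ gt = subst (_< τ c′) (sym τ′c′≡τc) gt

  module _ {Bad : Pred (Fin n → Fin n) 0ℓ}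
           (crossing⇒Bad : ∀ {τ τ′ c c′} → τ ∼ τ′ → Crossing τ τ′ c c′ → c < c′ → Bad τ ⊎ Bad τ′)
           where

    no-crossing : ∀ {τ τ′ c c′} → τ ∼ τ′ → ¬ Bad τ → ¬ Bad τ′ → ¬ Crossing τ τ′ c c′
    no-crossing {c = c} {c′} τ∼τ′ τ-good τ′-good X with <-cmp c c′
    ... | tri< c<c′ _ _ = [ τ-good , τ′-good ]′ (crossing⇒Bad τ∼τ′ X c<c′)
    ... | tri≈ _ refl _ = <-irrefl (Crossing.meet X) (Crossing.rise X)
    ... | tri> _ _ c′<c = [ τ′-good , τ-good ]′ (crossing⇒Bad (∼-sym τ∼τ′) (Crossing-sym X) c′<c)

    ∼-unique : ∀ {τ τ′} → Injective _≡_ _≡_ τ → Injective _≡_ _≡_ τ′ → τ ∼ τ′ →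
               ¬ Bad τ → ¬ Bad τ′ → τ ≗ τ′
    ∼-unique {τ} {τ′} τ-injective τ′-injective τ∼τ′ τ-good τ′-good x =
      agree-at τ-injective τ′-injective τ∼τ′ τ-good τ′-good (agree-below (<-wellFounded (τ x)))
      where
      agree-at : ∀ {τ τ′ x} → Injective _≡_ _≡_ τ → Injective _≡_ _≡_ τ′ → τ ∼ τ′ →
                 ¬ Bad τ → ¬ Bad τ′ → AgreeBelow τ τ′ (τ x) → τ x ≡ τ′ x
      agree-at {τ} {τ′} {x} τ-inj τ′-inj τ∼τ′ τ-good τ′-good agree with τ x ≟ τ′ x
      ... | yes τx≡τ′x = τx≡τ′x
      ... | no τx≢τ′x  = ⊥-elim (no-crossing τ∼τ′ τ-good τ′-good
                                  (proj₂ (disagreement⇒crossing τ-inj τ′-inj agree τx≢τ′x)))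
      agree-below : ∀ {v} → Acc _<_ v → AgreeBelow τ τ′ v
      agree-below (acc smaller) y (inj₁ τy<v)  =
        agree-at τ-injective τ′-injective τ∼τ′ τ-good τ′-good (agree-below (smaller τy<v))
      agree-below (acc smaller) y (inj₂ τ′y<v) = sym (agree-at τ′-injective τ-injective (∼-sym τ∼τ′)
        τ′-good τ-good (AgreeBelow-sym (agree-below (smaller τ′y<v))))

  ∼-unique> : ∀ {τ τ′} → Injective _≡_ _≡_ τ → Injective _≡_ _≡_ τ′ → τ ∼ τ′ →
              ¬ BadPair _>_ τ → ¬ BadPair _>_ τ′ → τ ≗ τ′
  ∼-unique> = ∼-unique crossing⇒BadPair>

  ∼-unique< : ∀ {τ τ′} → Injective _≡_ _≡_ τ → Injective _≡_ _≡_ τ′ → τ ∼ τ′ →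
              ¬ BadPair _<_ τ → ¬ BadPair _<_ τ′ → τ ≗ τ′
  ∼-unique< = ∼-unique crossing⇒BadPair<

module _ {n : ℕ} (π : Vec (Fin n) n) where

  private
    σ = lookup π

  -- κ lists the values of the occurrence in increasing order.
  contains⁺ : ∀ {k} {p : Vec (Fin k) k} (ι κ : Vec (Fin n) k) → Linked _<_ ι → Linked _<_ κ →
              Vec.map σ ι ≡ Vec.map (lookup κ) p → Contains π p
  contains⁺ {p = p} ι κ ι↑ κ↑ σ∘ι≡κ∘p = lookup ι , (λ _ _ → lookup⁺ <-trans ι↑) , λ a b →
    (λ lt → StrictlyIncreasing⇒reflects-< κ↑′ (subst₂ _<_ (value a) (value b) lt)) ,
    (λ lt → subst₂ _<_ (sym (value a)) (sym (value b)) (κ↑′ _ _ lt))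
    where
    κ↑′ : StrictlyIncreasing (lookup κ)
    κ↑′ _ _ = lookup⁺ <-trans κ↑
    value : ∀ a → σ (lookup ι a) ≡ lookup κ (lookup p a)
    value a = begin
      σ (lookup ι a)                  ≡⟨ lookup-map a σ ι ⟨
      lookup (Vec.map σ ι) a          ≡⟨ cong (λ w → lookup w a) σ∘ι≡κ∘p ⟩
      lookup (Vec.map (lookup κ) p) a ≡⟨ lookup-map a (lookup κ) p ⟩
      lookup κ (lookup p a)           ∎
      where open ≡-Reasoning

  occurrence : ∀ {p : Vec (Fin 5) 5} {i j k l m} → i < j → j < k → k < l → l < m →
               (κ : Vec (Fin n) 5) → Linked _<_ κ →
               Vec.map σ (i ∷ j ∷ k ∷ l ∷ m ∷ []) ≡ Vec.map (lookup κ) p → Contains π p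
  occurrence i<j j<k k<l l<m κ = contains⁺ _ κ (i<j ∷ j<k ∷ k<l ∷ l<m ∷ [-])

  BadPair>⇒contains : Injective _≡_ _≡_ σ → BadPair _>_ σ → Contains π p31245 ⊎ Contains π p32145
  BadPair>⇒contains σ-injective
    (badPair {l} {m} l<m σl<σm (i , j , k , i<j , j<k , k<l , σj<σi , σk<σi , σi<σl) _)
    with <-cmp (σ j) (σ k)
  ... | tri< σj<σk _ _ = inj₁ (occurrence i<j j<k k<l l<m (σ j ∷ σ k ∷ σ i ∷ σ l ∷ σ m ∷ [])
                                          (σj<σk ∷ σk<σi ∷ σi<σl ∷ σl<σm ∷ [-]) refl)
  ... | tri≈ _ σj≡σk _ = contradiction (σ-injective σj≡σk) (<⇒≢ j<k)
  ... | tri> _ _ σk<σj = inj₂ (occurrence i<j j<k k<l l<m (σ k ∷ σ j ∷ σ i ∷ σ l ∷ σ m ∷ [])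
                                          (σk<σj ∷ σj<σi ∷ σi<σl ∷ σl<σm ∷ [-]) refl)

  BadPair<⇒contains : Injective _≡_ _≡_ σ → BadPair _<_ σ → Contains π p31254 ⊎ Contains π p32154
  BadPair<⇒contains σ-injective
    (badPair {l} {m} l<m σm<σl _ (i , j , k , i<j , j<k , k<l , σj<σi , σk<σi , σi<σm))
    with <-cmp (σ j) (σ k)
  ... | tri< σj<σk _ _ = inj₁ (occurrence i<j j<k k<l l<m (σ j ∷ σ k ∷ σ i ∷ σ m ∷ σ l ∷ [])
                                          (σj<σk ∷ σk<σi ∷ σi<σm ∷ σm<σl ∷ [-]) refl)
  ... | tri≈ _ σj≡σk _ = contradiction (σ-injective σj≡σk) (<⇒≢ j<k)
  ... | tri> _ _ σk<σj = inj₂ (occurrence i<j j<k k<l l<m (σ k ∷ σ j ∷ σ i ∷ σ m ∷ σ l ∷ [])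
                                          (σk<σj ∷ σj<σi ∷ σi<σm ∷ σm<σl ∷ [-]) refl)

  occurrence-peak : ∀ {v} (ι : Fin 5 → Fin n) → StrictlyIncreasing ι →
                    σ (ι 1F) < σ (ι 0F) → σ (ι 2F) < σ (ι 0F) → σ (ι 0F) < v → Peak σ (ι 3F) v
  occurrence-peak ι ι↑ σι1<σι0 σι2<σι0 σι0<v =
    ι 0F , ι 1F , ι 2F , ι↑ _ _ z<s , ι↑ _ _ (s<s z<s) , ι↑ _ _ (s<s (s<s z<s)) ,
    σι1<σι0 , σι2<σι0 , σι0<v

  -- For a concrete pattern p the implicit True arguments reduce to ⊤ and are filled in
  -- automatically.
  contains⇒BadPair> : ∀ p → let _◃_ = λ a b → True (lookup p a <? lookup p b) in
    {_ : 1F ◃ 0F} {_ : 2F ◃ 0F} {_ : 0F ◃ 3F} {_ : 3F ◃ 4F} → Contains π p → BadPair _>_ σ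
  contains⇒BadPair> p {p₁<p₀} {p₂<p₀} {p₀<p₃} {p₃<p₄} (ι , ι↑ , order) =
    badPair (ι↑ _ _ (s<s (s<s (s<s z<s)))) σι3<σι4 ι3-active
            (Peak-mono ≤-refl (<⇒≤ σι3<σι4) ι3-active)
    where
    ord : ∀ a b → True (lookup p a <? lookup p b) → σ (ι a) < σ (ι b)
    ord a b pa<pb = proj₂ (order a b) (toWitness pa<pb)
    σι3<σι4 : σ (ι 3F) < σ (ι 4F)
    σι3<σι4 = ord 3F 4F p₃<p₄
    ι3-active : Active σ (ι 3F)
    ι3-active = occurrence-peak ι ι↑ (ord 1F 0F p₁<p₀) (ord 2F 0F p₂<p₀) (ord 0F 3F p₀<p₃)

  contains⇒BadPair< : ∀ p → let _◃_ = λ a b → True (lookup p a <? lookup p b) in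
    {_ : 1F ◃ 0F} {_ : 2F ◃ 0F} {_ : 0F ◃ 4F} {_ : 4F ◃ 3F} → Contains π p → BadPair _<_ σ
  contains⇒BadPair< p {p₁<p₀} {p₂<p₀} {p₀<p₄} {p₄<p₃} (ι , ι↑ , order) =
    badPair (ι↑ _ _ (s<s (s<s (s<s z<s)))) σι4<σι3 (Peak-mono ≤-refl (<⇒≤ σι4<σι3) peak) peak
    where
    ord : ∀ a b → True (lookup p a <? lookup p b) → σ (ι a) < σ (ι b)
    ord a b pa<pb = proj₂ (order a b) (toWitness pa<pb)
    σι4<σι3 : σ (ι 4F) < σ (ι 3F)
    σι4<σι3 = ord 4F 3F p₄<p₃
    peak : Peak σ (ι 3F) (σ (ι 4F))
    peak = occurrence-peak ι ι↑ (ord 1F 0F p₁<p₀) (ord 2F 0F p₂<p₀) (ord 0F 4F p₀<p₄)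

  avoids⇒¬BadPair> : IsPerm π → AvoidsBoth p31245 p32145 π → ¬ BadPair _>_ σ
  avoids⇒¬BadPair> π! (avoids₁ , avoids₂) =
    [ avoids₁ , avoids₂ ]′ ∘ BadPair>⇒contains (IsPerm⇒injective π!)

  ¬BadPair>⇒avoids : ¬ BadPair _>_ σ → AvoidsBoth p31245 p32145 π
  ¬BadPair>⇒avoids good = good ∘ contains⇒BadPair> p31245 , good ∘ contains⇒BadPair> p32145

  avoids⇒¬BadPair< : IsPerm π → AvoidsBoth p31254 p32154 π → ¬ BadPair _<_ σ
  avoids⇒¬BadPair< π! (avoids₁ , avoids₂) =
    [ avoids₁ , avoids₂ ]′ ∘ BadPair<⇒contains (IsPerm⇒injective π!)

  ¬BadPair<⇒avoids : ¬ BadPair _<_ σ → AvoidsBoth p31254 p32154 π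
  ¬BadPair<⇒avoids good = good ∘ contains⇒BadPair< p31254 , good ∘ contains⇒BadPair< p32154

module _ {n : ℕ} {_≺ₛ_ _≺ₜ_ : Rel (Fin n) 0ℓ} {P Q : Pred (Vec (Fin n) n) 0ℓ} where

  open Normalisation

  count-≤ : (P? : ∀ π → DecPerm P π) (Q? : ∀ π → DecPerm Q π) →
            (∀ σ → Normalisation (BadPair _≺ₜ_) σ) →
            (∀ {τ τ′} → Injective _≡_ _≡_ τ → Injective _≡_ _≡_ τ′ → τ ∼ τ′ →
               ¬ BadPair _≺ₛ_ τ → ¬ BadPair _≺ₛ_ τ′ → τ ≗ τ′) →
            (∀ π → IsPerm π → P π → ¬ BadPair _≺ₛ_ (lookup π)) →
            (∀ π → ¬ BadPair _≺ₜ_ (lookup π) → Q π) →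
            countPerms n P P? ≤ countPerms n Q Q?
  count-≤ P? Q? normal unique P⇒good good⇒Q =
    length-filter-≤ F F-injective P? Q? (allWords-unique n) allWords-complete F-maps
    where
    N : ∀ π → Normalisation (BadPair _≺ₜ_) (lookup π)
    N π = normal (lookup π)
    F : Vec (Fin n) n → Vec (Fin n) n
    F π = tabulate (form (N π))
    F-maps : ∀ {π} → IsPerm π × P π → IsPerm (F π) × Q (F π)
    F-maps {π} (π! , _) =
      injective⇒IsPerm (form-injective (N π) (IsPerm⇒injective π!)) ,
      good⇒Q (F π) (form-good (N π) ∘ BadPair-resp-≗ (lookup∘tabulate (form (N π))))
    F-injective : ∀ {π π′} → IsPerm π × P π → IsPerm π′ × P π′ → F π ≡ F π′ → π ≡ π′
    F-injective {π} {π′} (π! , Pπ) (π′! , Pπ′) Fπ≡Fπ′ = begin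
      π                    ≡⟨ tabulate∘lookup π ⟨
      tabulate (lookup π)  ≡⟨ tabulate-cong (unique (IsPerm⇒injective π!) (IsPerm⇒injective π′!)
                                π∼π′ (P⇒good π π! Pπ) (P⇒good π′ π′! Pπ′)) ⟩
      tabulate (lookup π′) ≡⟨ tabulate∘lookup π′ ⟩
      π′                   ∎
      where
      open ≡-Reasoning
      forms-agree : form (N π) ≗ form (N π′)
      forms-agree x = begin
        form (N π) x    ≡⟨ lookup∘tabulate (form (N π)) x ⟨
        lookup (F π) x  ≡⟨ cong (λ w → lookup w x) Fπ≡Fπ′ ⟩
        lookup (F π′) x ≡⟨ lookup∘tabulate (form (N π′)) x ⟩
        form (N π′) x   ∎
      π∼π′ : lookup π ∼ lookup π′
      π∼π′ = ∼-trans (∼form (N π)) (∼-trans (≗⇒∼ forms-agree) (∼-sym (∼form (N π′))))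

lemma4p2 : (n : ℕ) → 1 ≤ n →
    (d₁ : ∀ v → DecPerm (AvoidsBoth p31245 p32145) v) →
    (d₂ : ∀ v → DecPerm (AvoidsBoth p31254 p32154) v) →
    countPerms n (AvoidsBoth p31245 p32145) d₁ ≡ countPerms n (AvoidsBoth p31254 p32154) d₂
lemma4p2 n _ d₁ d₂ = ≤-antisym
  (count-≤ d₁ d₂ normalise< ∼-unique> avoids⇒¬BadPair> ¬BadPair<⇒avoids)
  (count-≤ d₂ d₁ normalise> ∼-unique< avoids⇒¬BadPair< ¬BadPair>⇒avoids)
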